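{- Let $r\ge 2$ and let $\mathcal{F}$ be an $r$-wise intersecting family of sets with covering number $\tau(\mathcal{F})=t$. Then $\mathcal{F}$ is $[(r-2)(t-1)+1]$-intersecting, i.e. $|F\cap F'|\ge (r-2)(t-1)+1$ for all $F,F'\in\mathcal{F}$.
   Context: A family $\mathcal{F}$ is $r$-wise intersecting if $F_1\cap\dots\cap F_r\neq\emptyset$ for all $F_1,\dots,F_r\in\mathcal{F}$. The covering number $\tau(\mathcal{F})$ is the smallest size of a set $C$ with $C\cap F\neq\emptyset$ for all $F\in\mathcal{F}$. -}

module Defs where

open import Data.Nat using (ℕ; _≤_)
open import Data.Fin using (Fin)
open import Data.Fin.Subset using (Subset; _∩_; ⋂; ∣_∣; Nonempty)
open import Data.List using (List)
open import Data.Vec using (Vec; lookup; toList)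
open import Data.List.Membership.Propositional renaming (_∈_ to _∈ₗ_)
open import Data.Product using (Σ; _×_)
open import Relation.Binary.PropositionalEquality using (_≡_)

Family : ℕ → Set
Family n = List (Subset n)

-- r-wise intersecting: any r members (repetitions allowed) have a common element.
RWiseIntersecting : ∀ {n} → ℕ → Family n → Set
RWiseIntersecting {n} r 𝓕 =
  (Fs : Vec (Subset n) r) → (∀ i → lookup Fs i ∈ₗ 𝓕) → Nonempty (⋂ (toList Fs))

Covers : ∀ {n} → Subset n → Family n → Set
Covers C 𝓕 = ∀ F → F ∈ₗ 𝓕 → Nonempty (C ∩ F)

CoveringNumber : ∀ {n} → Family n → ℕ → Set
CoveringNumber {n} 𝓕 t =
  Σ (Subset n) (λ C → Covers C 𝓕 × ∣ C ∣ ≡ t) × (∀ C → Covers C 𝓕 → t ≤ ∣ C ∣)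

-- Suppose |F ∩ F′| ≤ (r − 2)(t − 1). Cut F ∩ F′ into r − 2 pieces of at most t − 1 < τ
-- elements each. No piece is a cover, so every piece is missed by some member of 𝓕; these
-- r − 2 members together with F and F′ then have empty intersection, contradicting r-wise
-- intersection.
module Submission where

open import Defs
open import Data.Nat using (ℕ; _≤_; _<_; _+_; _*_; _∸_; zero; suc; z≤n; s≤s)
open import Data.Nat.Properties using (≤-trans; ≤-reflexive; <-≤-trans; <⇒≱; ≮⇒≥; m<1+n⇒m≤n; +-comm; ∸-monoˡ-≤; m+n∸m≡n)
open import Data.Fin using (Fin)
import Data.Fin as Fin
open import Data.Fin.Subset using (Subset; _∩_; _─_; ∣_∣; Empty; ⋂; _∈_; inside; outside; ⊥)
open import Data.Fin.Subset.Properties using (_∈?_; nonempty?; x∈p∩q⁻; x∈p∩q⁺; x∈p∧x∉q⇒x∈p─q; p─⊥≡p; ∣⊥∣≡0; ∩-assoc)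
open import Data.List.Membership.Propositional using (find) renaming (_∈_ to _∈ₗ_)
open import Data.List.Relation.Unary.All using (all?)
import Data.List.Relation.Unary.All as All
open import Data.List.Relation.Unary.All.Properties using (¬All⇒Any¬)
open import Data.Vec using (Vec; lookup; toList) renaming ([] to []ᵥ; _∷_ to _∷ᵥ_)
open import Data.Vec.Base using (there)
open import Data.Product using (Σ; ∃; _×_; _,_; proj₁; proj₂)
open import Relation.Nullary using (yes; no; contradiction)
open import Relation.Binary.PropositionalEquality using (refl; cong; sym; subst)

private
  variable
    n k : ℕ

x∈p⇒0<∣p∣ : ∀ {x : Fin n} {p : Subset n} → x ∈ p → 0 < ∣ p ∣
x∈p⇒0<∣p∣ {p = inside  ∷ᵥ p} _           = s≤s z≤n
x∈p⇒0<∣p∣ {p = outside ∷ᵥ p} (there x∈p) = x∈p⇒0<∣p∣ x∈p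

take : ℕ → Subset n → Subset n
take zero    p              = ⊥
take (suc m) []ᵥ            = []ᵥ
take (suc m) (inside  ∷ᵥ p) = inside ∷ᵥ take m p
take (suc m) (outside ∷ᵥ p) = outside ∷ᵥ take (suc m) p

∣take∣≤m : ∀ m (p : Subset n) → ∣ take m p ∣ ≤ m
∣take∣≤m {n} zero p              = ≤-reflexive (∣⊥∣≡0 n)
∣take∣≤m (suc m) []ᵥ            = z≤n
∣take∣≤m (suc m) (inside  ∷ᵥ p) = s≤s (∣take∣≤m m p)
∣take∣≤m (suc m) (outside ∷ᵥ p) = ∣take∣≤m (suc m) p

∣p─take∣≤∣p∣∸m : ∀ m (p : Subset n) → ∣ p ─ take m p ∣ ≤ ∣ p ∣ ∸ m
∣p─take∣≤∣p∣∸m zero    p              = ≤-reflexive (cong ∣_∣ (p─⊥≡p p))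
∣p─take∣≤∣p∣∸m (suc m) []ᵥ            = z≤n
∣p─take∣≤∣p∣∸m (suc m) (inside  ∷ᵥ p) = ∣p─take∣≤∣p∣∸m m p
∣p─take∣≤∣p∣∸m (suc m) (outside ∷ᵥ p) = ∣p─take∣≤∣p∣∸m (suc m) p

∣p∣≤[1+k]m⇒∣p─take∣≤km : ∀ k m (p : Subset n) → ∣ p ∣ ≤ suc k * m → ∣ p ─ take m p ∣ ≤ k * m
∣p∣≤[1+k]m⇒∣p─take∣≤km k m p ∣p∣≤ =
  ≤-trans (∣p─take∣≤∣p∣∸m m p) (≤-trans (∸-monoˡ-≤ m ∣p∣≤) (≤-reflexive (m+n∸m≡n m (k * m))))

Empty-∩-split : ∀ (p q : Subset n) {r s} → Empty (q ∩ r) → Empty ((p ─ q) ∩ s) → Empty (p ∩ (r ∩ s))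
Empty-∩-split p q {r} {s} q∩r=∅ [p─q]∩s=∅ (x , x∈p∩r∩s)
  with x∈p , x∈r∩s ← x∈p∩q⁻ p _ x∈p∩r∩s
  with x∈r , x∈s ← x∈p∩q⁻ r s x∈r∩s
  with x ∈? q
... | yes x∈q = q∩r=∅ (x , x∈p∩q⁺ (x∈q , x∈r))
... | no  x∉q = [p─q]∩s=∅ (x , x∈p∩q⁺ (x∈p∧x∉q⇒x∈p─q x∈p x∉q , x∈s))

MembersOf : Family n → Vec (Subset n) k → Set
MembersOf 𝓕 Gs = ∀ i → lookup Gs i ∈ₗ 𝓕

infixr 5 _∷ᵐ_
_∷ᵐ_ : ∀ {𝓕 : Family n} {G} {Gs : Vec (Subset n) k} → G ∈ₗ 𝓕 → MembersOf 𝓕 Gs → MembersOf 𝓕 (G ∷ᵥ Gs)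
(G∈ ∷ᵐ Gs∈) Fin.zero    = G∈
(G∈ ∷ᵐ Gs∈) (Fin.suc i) = Gs∈ i

member⇒0<τ : ∀ {𝓕 : Family n} {t F} → CoveringNumber 𝓕 t → F ∈ₗ 𝓕 → 0 < t
member⇒0<τ ((C , C-covers , refl) , _) F∈ = x∈p⇒0<∣p∣ (proj₁ (x∈p∩q⁻ C _ (proj₂ (C-covers _ F∈))))

∣C∣<τ⇒disjointMember : ∀ {𝓕 : Family n} {t} {C : Subset n} → (∀ C → Covers C 𝓕 → t ≤ ∣ C ∣) →
  ∣ C ∣ < t → ∃ λ G → G ∈ₗ 𝓕 × Empty (C ∩ G)
∣C∣<τ⇒disjointMember {𝓕 = 𝓕} {C = C} τ≤ ∣C∣<t with all? (λ G → nonempty? (C ∩ G)) 𝓕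
... | yes C-covers = contradiction (τ≤ C (λ _ → All.lookup C-covers)) (<⇒≱ ∣C∣<t)
... | no ¬C-covers = find (¬All⇒Any¬ (λ G → nonempty? (C ∩ G)) 𝓕 ¬C-covers)

disjointMembers : ∀ {𝓕 : Family n} {s} → (∀ C → Covers C 𝓕 → suc s ≤ ∣ C ∣) →
  ∀ k (S : Subset n) → ∣ S ∣ ≤ k * s →
  Σ (Vec (Subset n) k) λ Gs → MembersOf 𝓕 Gs × Empty (S ∩ ⋂ (toList Gs))
disjointMembers τ≤ zero S ∣S∣≤0 =
  []ᵥ , (λ ()) , λ (x , x∈S∩⊤) → <⇒≱ (x∈p⇒0<∣p∣ (proj₁ (x∈p∩q⁻ S _ x∈S∩⊤))) ∣S∣≤0
disjointMembers {s = s} τ≤ (suc k) S ∣S∣≤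
  with G , G∈ , A∩G=∅ ← ∣C∣<τ⇒disjointMember τ≤ (s≤s (∣take∣≤m s S))
  with Gs , Gs∈ , B∩⋂Gs=∅ ← disjointMembers τ≤ k (S ─ take s S) (∣p∣≤[1+k]m⇒∣p─take∣≤km k s S ∣S∣≤)
  = G ∷ᵥ Gs , G∈ ∷ᵐ Gs∈ , Empty-∩-split S (take s S) A∩G=∅ B∩⋂Gs=∅

proposition2 : (n r t : ℕ) → 2 ≤ r → (𝓕 : Family n) → RWiseIntersecting r 𝓕 → CoveringNumber 𝓕 t →
    (F F′ : Subset n) → F ∈ₗ 𝓕 → F′ ∈ₗ 𝓕 → (r ∸ 2) * (t ∸ 1) + 1 ≤ ∣ F ∩ F′ ∣
proposition2 n 0 _ () 𝓕 _ _ F F′ _ _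
proposition2 n 1 _ (s≤s ()) 𝓕 _ _ F F′ _ _
proposition2 n (suc (suc k)) zero _ 𝓕 _ τ F _ F∈ _ = contradiction (member⇒0<τ τ F∈) λ ()
proposition2 n (suc (suc k)) (suc s) _ 𝓕 intersecting (_ , τ≤) F F′ F∈ F′∈ = ≮⇒≥ λ ∣F∩F′∣<k*s+1 →
  let Gs , Gs∈ , F∩F′∩⋂Gs=∅ = disjointMembers τ≤ k (F ∩ F′)
                                 (m<1+n⇒m≤n (<-≤-trans ∣F∩F′∣<k*s+1 (≤-reflexive (+-comm (k * s) 1))))
      x , x∈⋂ = intersecting (F ∷ᵥ F′ ∷ᵥ Gs) (F∈ ∷ᵐ F′∈ ∷ᵐ Gs∈)
  in F∩F′∩⋂Gs=∅ (x , subst (x ∈_) (sym (∩-assoc F F′ _)) x∈⋂)
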